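{- Let $c_1,\ldots,c_n\in P$. The relation $\le$ between sets (defined for disjoint $X,Y\subseteq P$ by: $X\le Y$ iff there exist $x\in X$, $y\in Y$ with $x\le y$, and extended reflexively so that $X\le X$) is a partial order on the set of orbits of $(\mathbb P,c_1,\ldots,c_n)$.
   Context: $\mathbb P=(P;\leq)$ is the random partial order: the unique (up to isomorphism) countable homogeneous partial order into which every finite partial order embeds. The orbits of $(\mathbb P,c_1,\ldots,c_n)$ are the orbits on $P$ of the pointwise stabilizer of $c_1,\ldots,c_n$ in $\mathrm{Aut}(\mathbb P)$. -}

module Defs where

open import Data.Nat using (ℕ)
open import Level using (0ℓ)
open import Data.Fin using (Fin)
open import Data.Product using (Σ; ∃; _×_; _,_)
open import Data.Sum using (_⊎_)
open import Function.Bundles using (_↔_; _⇔_; Inverse; Surjection)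
open import Relation.Binary.Core using (Rel)
open import Relation.Binary.Structures using (IsPartialOrder)
open import Relation.Binary.PropositionalEquality using (_≡_)

IsAutomorphism : {P : Set} → Rel P 0ℓ → P ↔ P → Set
IsAutomorphism {P} _≤_ g = ∀ (a b : P) → (a ≤ b) ⇔ (Inverse.to g a ≤ Inverse.to g b)

record RandomPoset : Set₁ where
  field
    Carrier : Set
    _≤_ : Rel Carrier 0ℓ
    isPartialOrder : IsPartialOrder _≡_ _≤_
    countable : Surjection (Relation.Binary.PropositionalEquality.setoid ℕ)
                           (Relation.Binary.PropositionalEquality.setoid Carrier)
    -- homogeneous: a finite partial isomorphism a i ↦ b i
    -- (well defined and injective by antisymmetry) extends to an automorphism
    homogeneous : ∀ (k : ℕ) (a b : Fin k → Carrier) →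
                  (∀ i j → (a i ≤ a j) ⇔ (b i ≤ b j)) →
                  Σ (Carrier ↔ Carrier) λ g →
                    IsAutomorphism _≤_ g × (∀ i → Inverse.to g (a i) ≡ b i)
    universal : ∀ (k : ℕ) (R : Rel (Fin k) 0ℓ) → IsPartialOrder _≡_ R →
                Σ (Fin k → Carrier) λ f → ∀ i j → R i j ⇔ (f i ≤ f j)

module _ (ℙ : RandomPoset) where
  open RandomPoset ℙ

  SameOrbit : {n : ℕ} → (Fin n → Carrier) → Rel Carrier 0ℓ
  SameOrbit c x y = Σ (Carrier ↔ Carrier) λ g →
    IsAutomorphism _≤_ g × (∀ i → Inverse.to g (c i) ≡ c i) × (Inverse.to g x ≡ y)

  -- The relation ≤ between orbits, expressed via representatives:
  -- orb(x) ≤ orb(y) iff orb(x) = orb(y), or there are x' ∈ orb(x),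
  -- y' ∈ orb(y) with x' ≤ y'.
  OrbitLeq : {n : ℕ} → (Fin n → Carrier) → Rel Carrier 0ℓ
  OrbitLeq c x y = SameOrbit c x y ⊎
    ∃ λ x' → ∃ λ y' → SameOrbit c x x' × SameOrbit c y y' × (x' ≤ y')

-- Stabiliser orbits are the classes of an equivalence because the stabiliser
-- is a group, and transitivity of ≤ on orbits follows by moving one witnessing
-- pair with an automorphism so that the two pairs chain. For antisymmetry the
-- two witnesses chain to a ≤ b ≤ w with a and w in one orbit; then b is
-- comparable with each cᵢ exactly as a is, so homogeneity maps a, c to b, c and
-- a, b share an orbit.
module Submission where

open import Defs
open import Data.Nat using (ℕ)
open import Data.Fin using (Fin; zero; suc)
open import Data.Vec.Functional using (_∷_)
open import Data.Product using (∃; _×_; _,_)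
open import Data.Sum using (inj₁; inj₂)
open import Level using (0ℓ)
open import Function.Bundles using (_⇔_; Inverse; Equivalence; mk⇔)
open import Function.Properties.Inverse using (↔-refl; ↔-sym; ↔-trans)
open import Relation.Binary.Core using (Rel)
open import Relation.Binary.Structures using (IsPartialOrder; IsEquivalence)
open import Relation.Binary.PropositionalEquality
  using (_≡_; refl; sym; trans; cong; subst₂)

open Inverse using (to; from; strictlyInverseˡ; strictlyInverseʳ)

SameType : {P : Set} → Rel P 0ℓ → {k : ℕ} → Rel (Fin k → P) 0ℓ
SameType _≤_ a b = ∀ i j → (a i ≤ a j) ⇔ (b i ≤ b j)

module _ {P : Set} (_≤_ : Rel P 0ℓ) where

  automorphism-id : IsAutomorphism _≤_ ↔-refl
  automorphism-id a b = mk⇔ (λ le → le) (λ le → le)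

  automorphism-sym : ∀ {g} → IsAutomorphism _≤_ g → IsAutomorphism _≤_ (↔-sym g)
  automorphism-sym {g} A a b = mk⇔
    (λ le → Equivalence.from (A (from g a) (from g b))
              (subst₂ _≤_ (sym (strictlyInverseˡ g a)) (sym (strictlyInverseˡ g b)) le))
    (λ le → subst₂ _≤_ (strictlyInverseˡ g a) (strictlyInverseˡ g b)
              (Equivalence.to (A (from g a) (from g b)) le))

  automorphism-trans : ∀ {f g} → IsAutomorphism _≤_ f → IsAutomorphism _≤_ g →
                       IsAutomorphism _≤_ (↔-trans f g)
  automorphism-trans {f} F G a b = mk⇔
    (λ le → Equivalence.to (G (to f a) (to f b)) (Equivalence.to (F a b) le))
    (λ le → Equivalence.from (F a b) (Equivalence.from (G (to f a) (to f b)) le))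

  automorphism-sameType : ∀ {g} → IsAutomorphism _≤_ g → ∀ {k} {a b : Fin k → P} →
                          (∀ i → to g (a i) ≡ b i) → SameType _≤_ a b
  automorphism-sameType A {a = a} ga≡b i j = mk⇔
    (λ le → subst₂ _≤_ (ga≡b i) (ga≡b j) (Equivalence.to (A (a i) (a j)) le))
    (λ le → Equivalence.from (A (a i) (a j))
              (subst₂ _≤_ (sym (ga≡b i)) (sym (ga≡b j)) le))

module _ (ℙ : RandomPoset) {n : ℕ} (c : Fin n → RandomPoset.Carrier ℙ) where
  open RandomPoset ℙ
  private
    module ≤ = IsPartialOrder isPartialOrder
    _~_ = SameOrbit ℙ c
    _⊑_ = OrbitLeq ℙ c

  sameOrbit-isEquivalence : IsEquivalence _~_
  sameOrbit-isEquivalence = record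
    { refl  = ↔-refl , automorphism-id _≤_ , (λ _ → refl) , refl
    ; sym   = λ { {x} (g , A , fixes , gx≡y) →
        ↔-sym g , automorphism-sym _≤_ {g} A ,
        (λ i → trans (cong (from g) (sym (fixes i))) (strictlyInverseʳ g (c i))) ,
        trans (cong (from g) (sym gx≡y)) (strictlyInverseʳ g x) }
    ; trans = λ (f , F , f-fixes , fx≡y) (g , G , g-fixes , gy≡z) →
        ↔-trans f g , automorphism-trans _≤_ {f} {g} F G ,
        (λ i → trans (cong (to g) (f-fixes i)) (g-fixes i)) ,
        trans (cong (to g) fx≡y) gy≡z
    }

  private
    module ~ = IsEquivalence sameOrbit-isEquivalence

  sameOrbit-transport-≤ : ∀ {x x' y} → x ~ x' → x ≤ y → ∃ λ y' → y ~ y' × x' ≤ y'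
  sameOrbit-transport-≤ {y = y} (g , A , fixes , gx≡x') x≤y =
    to g y , (g , A , fixes , refl) ,
    subst₂ _≤_ gx≡x' refl (Equivalence.to (A _ y) x≤y)

  sameOrbit⇒sameType : ∀ {a w} → a ~ w → SameType _≤_ (a ∷ c) (w ∷ c)
  sameOrbit⇒sameType (g , A , fixes , ga≡w) = automorphism-sameType _≤_ {g} A λ
    { zero    → ga≡w
    ; (suc i) → fixes i }

  sameType⇒sameOrbit : ∀ {a b} → SameType _≤_ (a ∷ c) (b ∷ c) → a ~ b
  sameType⇒sameOrbit {a} {b} a≅b with homogeneous _ (a ∷ c) (b ∷ c) a≅b
  ... | g , A , g[a∷c]≡b∷c = g , A , (λ i → g[a∷c]≡b∷c (suc i)) , g[a∷c]≡b∷c zero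

  sameOrbit-convex : ∀ {a b w} → a ≤ b → b ≤ w → a ~ w → a ~ b
  sameOrbit-convex {a} {b} {w} a≤b b≤w a~w = sameType⇒sameOrbit a≅b
    where
    a≅w = sameOrbit⇒sameType a~w
    a≅b : SameType _≤_ (a ∷ c) (b ∷ c)
    a≅b zero    zero    = mk⇔ (λ _ → ≤.refl) (λ _ → ≤.refl)
    a≅b zero    (suc j) = mk⇔ (λ a≤cⱼ → ≤.trans b≤w (Equivalence.to (a≅w zero (suc j)) a≤cⱼ))
                              (≤.trans a≤b)
    a≅b (suc i) zero    = mk⇔ (λ cᵢ≤a → ≤.trans cᵢ≤a a≤b)
                              (λ cᵢ≤b → Equivalence.from (a≅w (suc i) zero) (≤.trans cᵢ≤b b≤w))
    a≅b (suc i) (suc j) = mk⇔ (λ le → le) (λ le → le)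

  orbitLeq-trans : ∀ {x y z} → x ⊑ y → y ⊑ z → x ⊑ z
  orbitLeq-trans (inj₁ x~y) (inj₁ y~z) = inj₁ (~.trans x~y y~z)
  orbitLeq-trans (inj₁ x~y) (inj₂ (y' , z' , y~y' , z~z' , y'≤z')) =
    inj₂ (y' , z' , ~.trans x~y y~y' , z~z' , y'≤z')
  orbitLeq-trans (inj₂ (x' , y' , x~x' , y~y' , x'≤y')) (inj₁ y~z) =
    inj₂ (x' , y' , x~x' , ~.trans (~.sym y~z) y~y' , x'≤y')
  orbitLeq-trans (inj₂ (x' , y' , x~x' , y~y' , x'≤y')) (inj₂ (y'' , z' , y~y'' , z~z' , y''≤z'))
    with sameOrbit-transport-≤ (~.trans (~.sym y~y'') y~y') y''≤z'
  ... | w , z'~w , y'≤w = inj₂ (x' , w , x~x' , ~.trans z~z' z'~w , ≤.trans x'≤y' y'≤w)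

  orbitLeq-antisym : ∀ {x y} → x ⊑ y → y ⊑ x → x ~ y
  orbitLeq-antisym (inj₁ x~y) _ = x~y
  orbitLeq-antisym (inj₂ _) (inj₁ y~x) = ~.sym y~x
  orbitLeq-antisym (inj₂ (x' , y' , x~x' , y~y' , x'≤y')) (inj₂ (y'' , x'' , y~y'' , x~x'' , y''≤x''))
    with sameOrbit-transport-≤ (~.trans (~.sym y~y'') y~y') y''≤x''
  ... | w , x''~w , y'≤w =
    ~.trans x~x' (~.trans (sameOrbit-convex x'≤y' y'≤w x'~w) (~.sym y~y'))
    where x'~w = ~.trans (~.trans (~.sym x~x') x~x'') x''~w

mainTheorem19 : (ℙ : RandomPoset) (n : ℕ) (c : Fin n → RandomPoset.Carrier ℙ) →
    IsPartialOrder (SameOrbit ℙ c) (OrbitLeq ℙ c)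
mainTheorem19 ℙ n c = record
  { isPreorder = record
    { isEquivalence = sameOrbit-isEquivalence ℙ c
    ; reflexive     = inj₁
    ; trans         = orbitLeq-trans ℙ c
    }
  ; antisym = orbitLeq-antisym ℙ c
  }
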